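{- The poset $\mathcal{H}$ is a dcpo, and the lattice of Scott-open subsets of $\mathcal{H}$ is order-isomorphic to the lattice of Scott-open subsets of $\mathsf{Irr}(\mathcal{H})$ (equivalently, $\Gamma(\mathcal{H})\cong\Gamma(\mathsf{Irr}(\mathcal{H}))$).
   Context: Let $\mathbb{N}$ be the natural numbers and $\mathbb{N}^*$ the set of finite strings of natural numbers; $\varepsilon$ is the empty string, $n{:}s$ is the string obtained by putting $n$ in front of $s$, $ts$ is concatenation, and for a nonempty string $t$, $\min(t)$ is its least entry. On $\mathbb{N}\times\mathbb{N}^*$ define, for $m,m',n,n'\in\mathbb{N}$ and $s,t\in\mathbb{N}^*$: $(m,n{:}s)<_1(m,n'{:}s)$ if $n<n'$; $(m,ts)<_2(m,s)$ if $t\neq\varepsilon$; $(m,ts)<_3(m',s)$ if $t\ne\varepsilon$ and $\min(t)\le m'$. Let $<\;=\;<_1\cup<_2\cup<_3\cup(<_2;<_1)\cup(<_3;<_1)$, where $x\,(R;R')\,z$ means there is $y$ with $x\,R\,y$ and $y\,R'\,z$, and let $\le\;=\;<\cup=$. This is a partial order; $\mathcal{H}$ is the poset $(\mathbb{N}\times\mathbb{N}^*,\le)$. For a dcpo $D$, $\Gamma(D)$ is the lattice of Scott-closed sets under inclusion; a subset is irreducible if nonempty and whenever contained in a union of two Scott-closed sets it is contained in one of them; $\mathsf{Irr}(D)$ is the set of Scott-closed irreducible subsets of $D$ ordered by inclusion (itself a dcpo). -}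

module Defs where

open import Level using (Level; 0ℓ; _⊔_) renaming (suc to lsuc)
open import Data.Nat using (ℕ; _<_; _≤_; _⊓_)
open import Data.List using (List; []; _∷_; _++_; foldr)
open import Data.Product using (Σ; ∃; _×_; _,_; proj₁)
open import Data.Sum using (_⊎_)
open import Relation.Unary using (Pred; _⊆_; _∪_; _∈_)
open import Relation.Binary using (Rel)
open import Relation.Binary.PropositionalEquality using (_≡_)

-- The poset 𝓗 = ℕ × ℕ*   (strings are lists; n:s = n ∷ s, ts = t ++ s)

H : Set
H = ℕ × List ℕ

minL : ℕ → List ℕ → ℕ
minL x xs = foldr _⊓_ x xs

data _<₁_ : Rel H 0ℓ where
  lt1 : ∀ {m n n' s} → n < n' → (m , n ∷ s) <₁ (m , n' ∷ s)

data _<₂_ : Rel H 0ℓ where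
  lt2 : ∀ {m x xs s} → (m , (x ∷ xs) ++ s) <₂ (m , s)

data _<₃_ : Rel H 0ℓ where
  lt3 : ∀ {m m' x xs s} → minL x xs ≤ m' → (m , (x ∷ xs) ++ s) <₃ (m' , s)

_⨾_ : ∀ {a r s} {A : Set a} → Rel A r → Rel A s → Rel A (a ⊔ r ⊔ s)
(R ⨾ S) x z = ∃ λ y → R x y × S y z

_<H_ : Rel H 0ℓ
x <H y = x <₁ y ⊎ x <₂ y ⊎ x <₃ y ⊎ (_<₂_ ⨾ _<₁_) x y ⊎ (_<₃_ ⨾ _<₁_) x y

_≤H_ : Rel H 0ℓ
x ≤H y = x <H y ⊎ x ≡ y

module Order {a r : Level} {A : Set a} (_⊑_ : Rel A r) where

  IsUpperBound : ∀ {s} → Pred A s → A → Set (a ⊔ r ⊔ s)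
  IsUpperBound D u = ∀ {x} → x ∈ D → x ⊑ u

  IsSup : ∀ {s} → Pred A s → A → Set (a ⊔ r ⊔ s)
  IsSup D u = IsUpperBound D u × (∀ {v} → IsUpperBound D v → u ⊑ v)

  IsDirected : ∀ {s} → Pred A s → Set (a ⊔ r ⊔ s)
  IsDirected D = (∃ λ x → x ∈ D)
               × (∀ {x y} → x ∈ D → y ∈ D → ∃ λ z → z ∈ D × x ⊑ z × y ⊑ z)

  IsDirectedComplete : (s : Level) → Set (a ⊔ r ⊔ lsuc s)
  IsDirectedComplete s = (D : Pred A s) → IsDirected D → ∃ (IsSup D)

  IsLowerSet : ∀ {s} → Pred A s → Set (a ⊔ r ⊔ s)
  IsLowerSet C = ∀ {x y} → y ⊑ x → x ∈ C → y ∈ C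

  IsScottClosed : ∀ {s} → Pred A s → Set (a ⊔ r ⊔ lsuc s)
  IsScottClosed {s} C = IsLowerSet C
    × ((D : Pred A s) → IsDirected D → D ⊆ C → ∀ {u} → IsSup D u → u ∈ C)

  ScottClosed : (s : Level) → Set (a ⊔ r ⊔ lsuc s)
  ScottClosed s = Σ (Pred A s) IsScottClosed

  _⊆Γ_ : ∀ {s} → Rel (ScottClosed s) (a ⊔ s)
  C ⊆Γ D = proj₁ C ⊆ proj₁ D

  IsIrreducible : ∀ {s} → Pred A s → Set (a ⊔ r ⊔ lsuc s)
  IsIrreducible {s} C = (∃ λ x → x ∈ C)
    × ((P Q : Pred A s) → IsScottClosed P → IsScottClosed Q →
        C ⊆ P ∪ Q → C ⊆ P ⊎ C ⊆ Q)

-- Order isomorphism between preordered sets (inverse up to the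
-- induced equivalence, i.e. mutual ≤; for inclusion orders this is
-- extensional equality of sets)

record OrderIso {a b r s : Level} (A : Set a) (_≤A_ : Rel A r)
                (B : Set b) (_≤B_ : Rel B s) : Set (a ⊔ b ⊔ r ⊔ s) where
  field
    to        : A → B
    from      : B → A
    to-mono   : ∀ {x y} → x ≤A y → to x ≤B to y
    from-mono : ∀ {x y} → x ≤B y → from x ≤A from y
    from∘to   : ∀ x → from (to x) ≤A x × x ≤A from (to x)
    to∘from   : ∀ y → to (from y) ≤B y × y ≤B to (from y)

module OH = Order _≤H_

ΓH : Set₁
ΓH = OH.ScottClosed 0ℓ

IrrH : Set₁
IrrH = Σ (Pred H 0ℓ) (λ C → OH.IsScottClosed C × OH.IsIrreducible C)

_⊆Irr_ : Rel IrrH 0ℓ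
F ⊆Irr G = proj₁ F ⊆ proj₁ G

module OIrr = Order _⊆Irr_

ΓIrrH : Set₁
ΓIrrH = OIrr.ScottClosed 0ℓ

-- For any preorder A, C ↦ {F ∈ Irr A | F ⊆ C} and 𝒜 ↦ {x | ↓x ∈ 𝒜} are monotone maps between Γ(A)
-- and Γ(Irr A) (a directed sup in Irr A lies inside the closure of the union). They are mutually inverse
-- as soon as every irreducible closed set is a directed sup in Irr A of irreducibles lying below
-- principal ideals of its own points. For 𝓗 this holds because of the shape of ≤H: string length never
-- increases along ≤H, and at fixed length and first coordinate ≤H is a chain (m , k ∷ s), k ∈ ℕ, with
-- sup (m , s). So a directed set has a greatest element or is cofinal in such a chain, Scott-closed sets
-- are the lower sets closed under these chain sups, and an irreducible closed set is either principal or
-- {(c , w) | w ≼ s}, the directed sup of the sets {(c , w) | w ≼ n ∷ s} ⊆ ↓(n , s).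

module Submission where

open import Defs
open import Level using (0ℓ) renaming (suc to lsuc)
open import Axiom.ExcludedMiddle using (ExcludedMiddle)
open import Data.Nat using (ℕ; zero; suc; _<_; _≤_; _⊔_; _+_; s≤s; s≤s⁻¹; _≤?_)
open import Data.Nat.Properties
open import Data.Nat.Induction using (<-rec)
open import Data.List using (List; []; _∷_; _++_; length; [_])
open import Data.List.Properties using (++-assoc)
open import Data.List.Relation.Unary.Any as Any using (Any)
open import Data.List.Relation.Unary.Any.Properties using (++⁺ˡ; ++⁺ʳ)
open import Data.Product using (Σ; ∃; _×_; _,_; proj₁; proj₂)
open import Data.Sum using (_⊎_; inj₁; inj₂)
import Data.Sum as Sum
open import Data.Empty using (⊥; ⊥-elim)
open import Relation.Nullary using (¬_; yes; no)
open import Relation.Nullary.Decidable using (True; toWitness; fromWitness; decidable-stable)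
open import Relation.Binary using (Rel; IsPreorder; IsPartialOrder)
open import Relation.Binary.PropositionalEquality using (_≡_; refl; cong; subst; isEquivalence)
open import Relation.Unary using (Pred; _⊆_; _∈_; _∪_)

module IrreducibleCompletion {A : Set} {_≲_ : Rel A 0ℓ} (≲-isPreorder : IsPreorder _≡_ _≲_) where
  open IsPreorder ≲-isPreorder renaming (refl to ≲-refl; trans to ≲-trans)
  open Order _≲_

  Irr : Set₁
  Irr = Σ (Pred A 0ℓ) λ C → IsScottClosed C × IsIrreducible C

  _⊆ᴵ_ : Rel Irr 0ℓ
  F ⊆ᴵ G = proj₁ F ⊆ proj₁ G

  ⊆ᴵ-refl : ∀ {F} → F ⊆ᴵ F
  ⊆ᴵ-refl y∈F = y∈F

  module I = Order _⊆ᴵ_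

  ↓_ : A → Pred A 0ℓ
  ↓ x = _≲ x

  ↓-isScottClosed : ∀ x → IsScottClosed (↓ x)
  ↓-isScottClosed x = (λ y≲z z≲x → ≲-trans y≲z z≲x) , λ _ _ D⊆↓x sup → proj₂ sup D⊆↓x

  ↓-isIrreducible : ∀ x → IsIrreducible (↓ x)
  ↓-isIrreducible x = (x , ≲-refl) , λ P Q (P-lower , _) (Q-lower , _) ↓x⊆P∪Q →
    Sum.map (λ x∈P y≲x → P-lower y≲x x∈P) (λ x∈Q y≲x → Q-lower y≲x x∈Q) (↓x⊆P∪Q ≲-refl)

  principal : A → Irr
  principal x = ↓ x , ↓-isScottClosed x , ↓-isIrreducible x

  IsApproximable : Irr → Set₁
  IsApproximable F = Σ (Pred Irr 0ℓ) λ 𝒟 → I.IsDirected 𝒟 × I.IsSup 𝒟 F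
    × (∀ {G} → G ∈ 𝒟 → ∃ λ x → x ∈ proj₁ F × G ⊆ᴵ principal x)

  principal-isApproximable : ∀ F {x} → x ∈ proj₁ F → proj₁ F ⊆ ↓ x → IsApproximable F
  principal-isApproximable F {x} x∈F F⊆↓x =
    (_⊆ᴵ principal x) , directed , ((λ {G} → ub {G}) , (λ {V} → least {V})) , λ G⊆↓x → x , x∈F , G⊆↓x
    where
    ↓x⊆F : ↓ x ⊆ proj₁ F
    ↓x⊆F y≲x = proj₁ (proj₁ (proj₂ F)) y≲x x∈F
    directed : I.IsDirected (_⊆ᴵ principal x)
    directed = (principal x , ⊆ᴵ-refl {principal x}) , λ F₁⊆↓x F₂⊆↓x →
      principal x , ⊆ᴵ-refl {principal x} , F₁⊆↓x , F₂⊆↓x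
    ub : I.IsUpperBound (_⊆ᴵ principal x) F
    ub G⊆↓x y∈G = ↓x⊆F (G⊆↓x y∈G)
    least : ∀ {V} → I.IsUpperBound (_⊆ᴵ principal x) V → F ⊆ᴵ V
    least ubV y∈F = ubV {principal x} (⊆ᴵ-refl {principal x}) (F⊆↓x y∈F)

  idealsBelow : Pred A 0ℓ → Pred Irr 0ℓ
  idealsBelow D F = ∃ λ d → d ∈ D × F ⊆ᴵ principal d

  idealsBelow-isDirected : ∀ {D} → IsDirected D → I.IsDirected (idealsBelow D)
  idealsBelow-isDirected ((d , d∈D) , directed) =
    (principal d , d , d∈D , ⊆ᴵ-refl {principal d}) , λ (d₁ , d₁∈D , F₁⊆↓d₁) (d₂ , d₂∈D , F₂⊆↓d₂) →
      let (d , d∈D , d₁≲d , d₂≲d) = directed d₁∈D d₂∈D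
      in principal d , (d , d∈D , ⊆ᴵ-refl {principal d})
         , (λ y∈F₁ → ≲-trans (F₁⊆↓d₁ y∈F₁) d₁≲d) , (λ y∈F₂ → ≲-trans (F₂⊆↓d₂ y∈F₂) d₂≲d)

  principal-isSup-idealsBelow : ∀ {D u} → IsDirected D → IsSup D u →
    I.IsSup (idealsBelow D) (principal u)
  principal-isSup-idealsBelow {D} {u} D-directed (u-ub , u-least) =
    (λ {F} → ub {F}) , (λ {V} → least {V})
    where
    ub : I.IsUpperBound (idealsBelow D) (principal u)
    ub (d , d∈D , F⊆↓d) y∈F = ≲-trans (F⊆↓d y∈F) (u-ub d∈D)
    least : ∀ {V} → I.IsUpperBound (idealsBelow D) V → principal u ⊆ᴵ V
    least {V , (V-lower , V-closed) , _} ubV y≲u = V-lower y≲u u∈V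
      where
      u∈V : u ∈ V
      u∈V = V-closed D D-directed (λ d∈D → ubV {principal _} (_ , d∈D , ⊆ᴵ-refl {principal _}) ≲-refl)
                     (u-ub , u-least)

  module _ (em₀ : ExcludedMiddle 0ℓ) (em₁ : ExcludedMiddle (lsuc 0ℓ)) where

    InClosure⋃ : Pred Irr 0ℓ → A → Set₁
    InClosure⋃ 𝒟 y = ∀ P → IsScottClosed P → (∀ {F} → F ∈ 𝒟 → proj₁ F ⊆ P) → y ∈ P

    -- Membership in the intersection of all Scott-closed supersets of ⋃ 𝒟 is a proposition in Set₁;
    -- deciding it with excluded middle at that level yields a predicate in Set.
    closure⋃ : Pred Irr 0ℓ → Pred A 0ℓ
    closure⋃ 𝒟 y = True (em₁ {InClosure⋃ 𝒟 y})

    module _ {𝒟 : Pred Irr 0ℓ} where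

      closure⋃-intro : ∀ {y} → InClosure⋃ 𝒟 y → y ∈ closure⋃ 𝒟
      closure⋃-intro = fromWitness

      closure⋃-least : ∀ {P} → IsScottClosed P → (∀ {F} → F ∈ 𝒟 → proj₁ F ⊆ P) → closure⋃ 𝒟 ⊆ P
      closure⋃-least P-closed 𝒟⊆P y∈cl = toWitness y∈cl _ P-closed 𝒟⊆P

      ⊆-closure⋃ : ∀ {F} → F ∈ 𝒟 → proj₁ F ⊆ closure⋃ 𝒟
      ⊆-closure⋃ F∈𝒟 y∈F = closure⋃-intro λ _ _ 𝒟⊆P → 𝒟⊆P F∈𝒟 y∈F

      closure⋃-isScottClosed : IsScottClosed (closure⋃ 𝒟)
      closure⋃-isScottClosed =
        (λ y≲x x∈cl → closure⋃-intro λ P P-closed 𝒟⊆P →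
           proj₁ P-closed y≲x (closure⋃-least P-closed 𝒟⊆P x∈cl))
        , λ D D-directed D⊆cl sup → closure⋃-intro λ P P-closed 𝒟⊆P →
            proj₂ P-closed D D-directed (λ d∈D → closure⋃-least P-closed 𝒟⊆P (D⊆cl d∈D)) sup

      closure⋃⊈⇒member⊈ : ∀ {P} → IsScottClosed P → ¬ closure⋃ 𝒟 ⊆ P → ∃ λ F → F ∈ 𝒟 × ¬ proj₁ F ⊆ P
      closure⋃⊈⇒member⊈ {P} P-closed cl⊈P = decidable-stable em₁ λ ∄F →
        cl⊈P (closure⋃-least P-closed λ {F} F∈𝒟 y∈F →
          decidable-stable (em₀ {proj₁ F ⊆ P}) (λ F⊈P → ∄F (F , F∈𝒟 , F⊈P)) y∈F)

      closure⋃-isIrreducible : I.IsDirected 𝒟 → IsIrreducible (closure⋃ 𝒟)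
      closure⋃-isIrreducible ((F , F∈𝒟) , directed) = nonempty (proj₁ (proj₂ (proj₂ F))) , split
        where
        nonempty : (∃ λ y → y ∈ proj₁ F) → ∃ λ y → y ∈ closure⋃ 𝒟
        nonempty (y , y∈F) = y , ⊆-closure⋃ F∈𝒟 y∈F
        split : ∀ P Q → IsScottClosed P → IsScottClosed Q →
          closure⋃ 𝒟 ⊆ P ∪ Q → closure⋃ 𝒟 ⊆ P ⊎ closure⋃ 𝒟 ⊆ Q
        split P Q P-closed Q-closed cl⊆P∪Q with em₀ {closure⋃ 𝒟 ⊆ P} | em₀ {closure⋃ 𝒟 ⊆ Q}
        ... | yes cl⊆P | _ = inj₁ cl⊆P
        ... | no _ | yes cl⊆Q = inj₂ cl⊆Q
        ... | no cl⊈P | no cl⊈Q =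
          ⊥-elim (both-fail (closure⋃⊈⇒member⊈ P-closed cl⊈P) (closure⋃⊈⇒member⊈ Q-closed cl⊈Q))
          where
          both-fail : (∃ λ F₁ → F₁ ∈ 𝒟 × ¬ proj₁ F₁ ⊆ P) → (∃ λ F₂ → F₂ ∈ 𝒟 × ¬ proj₁ F₂ ⊆ Q) → ⊥
          both-fail (F₁ , F₁∈𝒟 , F₁⊈P) (F₂ , F₂∈𝒟 , F₂⊈Q) with directed F₁∈𝒟 F₂∈𝒟
          ... | G , G∈𝒟 , F₁⊆G , F₂⊆G
              with proj₂ (proj₂ (proj₂ G)) P Q P-closed Q-closed (λ y∈G → cl⊆P∪Q (⊆-closure⋃ G∈𝒟 y∈G))
          ...   | inj₁ G⊆P = F₁⊈P (λ y∈F₁ → G⊆P (F₁⊆G y∈F₁))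
          ...   | inj₂ G⊆Q = F₂⊈Q (λ y∈F₂ → G⊆Q (F₂⊆G y∈F₂))

      directedSup⊆closure⋃ : I.IsDirected 𝒟 → ∀ {U} → I.IsSup 𝒟 U → proj₁ U ⊆ closure⋃ 𝒟
      directedSup⊆closure⋃ 𝒟-directed (_ , U-least) =
        U-least {closure⋃ 𝒟 , closure⋃-isScottClosed , closure⋃-isIrreducible 𝒟-directed} ⊆-closure⋃

    irreducibleSubsets : ScottClosed 0ℓ → I.ScottClosed 0ℓ
    irreducibleSubsets (C , C-closed) = (λ F → proj₁ F ⊆ C)
      , (λ G⊆F F⊆C y∈G → F⊆C (G⊆F y∈G))
      , λ 𝒟 𝒟-directed 𝒟⊆C {U} sup y∈U →
          closure⋃-least {𝒟} C-closed (λ {F} → 𝒟⊆C {F})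
            (directedSup⊆closure⋃ {𝒟} 𝒟-directed {U} sup y∈U)

    principalPoints : I.ScottClosed 0ℓ → ScottClosed 0ℓ
    principalPoints (𝒜 , 𝒜-lower , 𝒜-closed) = (λ x → principal x ∈ 𝒜)
      , (λ y≲x ↓x∈𝒜 → 𝒜-lower (λ z≲y → ≲-trans z≲y y≲x) ↓x∈𝒜)
      , λ D D-directed D⊆𝒜 sup → 𝒜-closed (idealsBelow D) (idealsBelow-isDirected D-directed)
          (λ {F} (d , d∈D , F⊆↓d) → 𝒜-lower {principal d} {F} F⊆↓d (D⊆𝒜 d∈D))
          (principal-isSup-idealsBelow D-directed sup)

    Γ≅ΓIrr : (∀ F → IsApproximable F) → OrderIso (ScottClosed 0ℓ) _⊆Γ_ (I.ScottClosed 0ℓ) I._⊆Γ_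
    Γ≅ΓIrr approximable = record
      { to        = irreducibleSubsets
      ; from      = principalPoints
      ; to-mono   = λ C⊆C′ F⊆C y∈F → C⊆C′ (F⊆C y∈F)
      ; from-mono = λ 𝒜⊆ℬ ↓x∈𝒜 → 𝒜⊆ℬ ↓x∈𝒜
      ; from∘to   = λ (C , (C-lower , _)) → (λ ↓x⊆C → ↓x⊆C ≲-refl) , λ x∈C y≲x → C-lower y≲x x∈C
      ; to∘from   = λ (𝒜 , 𝒜-closed) → (λ {F} → principals∈⇒∈ 𝒜-closed F)
                    , λ {F} F∈𝒜 x∈F → proj₁ 𝒜-closed (λ y≲x → proj₁ (proj₁ (proj₂ F)) y≲x x∈F) F∈𝒜
      }
      where
      principals∈⇒∈ : ∀ {𝒜} → I.IsScottClosed 𝒜 → ∀ F → (∀ {x} → x ∈ proj₁ F → principal x ∈ 𝒜) → F ∈ 𝒜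
      principals∈⇒∈ (𝒜-lower , 𝒜-closed) F ↓F⊆𝒜 with approximable F
      ... | 𝒟 , 𝒟-directed , F-sup , below-points = 𝒜-closed 𝒟 𝒟-directed
        (λ G∈𝒟 → let (x , x∈F , G⊆↓x) = below-points G∈𝒟 in 𝒜-lower G⊆↓x (↓F⊆𝒜 x∈F)) F-sup

infix 4 _≼_ _⊏[_]_ _⊑_

-- A normal form for ≤H: (a , u) ≤H (m , s) iff either a ≡ m and u ≼ s, or u ⊏[ m ] s.
-- Here u ≼ s says u = t ++ s, or u = t ++ k ∷ s′ and s = k′ ∷ s′ with k < k′;
-- and u ⊏[ m ] s says u = t ++ x ∷ v with x ≤ m and v ≼ s.
data _≼_ : List ℕ → List ℕ → Set where
  same : ∀ {s} → s ≼ s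
  bump : ∀ {k k′ s} → k < k′ → k ∷ s ≼ k′ ∷ s
  cons : ∀ {x u s} → u ≼ s → x ∷ u ≼ s

data _⊏[_]_ : List ℕ → ℕ → List ℕ → Set where
  here  : ∀ {x u m s} → x ≤ m → u ≼ s → x ∷ u ⊏[ m ] s
  there : ∀ {x u m s} → u ⊏[ m ] s → x ∷ u ⊏[ m ] s

data _⊑_ : H → H → Set where
  along  : ∀ {m u s} → u ≼ s → (m , u) ⊑ (m , s)
  across : ∀ {a m u s} → u ⊏[ m ] s → (a , u) ⊑ (m , s)

len : H → ℕ
len x = length (proj₂ x)

≼-trans : ∀ {u v w} → u ≼ v → v ≼ w → u ≼ w
≼-trans same q = q
≼-trans (cons p) q = cons (≼-trans p q)
≼-trans (bump p) same = bump p
≼-trans (bump p) (bump q) = bump (<-trans p q)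
≼-trans (bump p) (cons q) = cons q

⊏-≼-trans : ∀ {m u v w} → u ⊏[ m ] v → v ≼ w → u ⊏[ m ] w
⊏-≼-trans (here x≤m p) q = here x≤m (≼-trans p q)
⊏-≼-trans (there e) q = there (⊏-≼-trans e q)

≼-⊏-trans : ∀ {m u v w} → u ≼ v → v ⊏[ m ] w → u ⊏[ m ] w
≼-⊏-trans same e = e
≼-⊏-trans (cons p) e = there (≼-⊏-trans p e)
≼-⊏-trans (bump k<k′) (here k′≤m q) = here (≤-trans (<⇒≤ k<k′) k′≤m) q
≼-⊏-trans (bump _) (there e) = there e

⊏⇒≼ : ∀ {m u s} → u ⊏[ m ] s → u ≼ s
⊏⇒≼ (here _ p) = cons p
⊏⇒≼ (there e) = cons (⊏⇒≼ e)

≼⇒⊏ : ∀ {n w s} → w ≼ n ∷ s → w ⊏[ n ] s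
≼⇒⊏ same = here ≤-refl same
≼⇒⊏ (bump k<n) = here (<⇒≤ k<n) same
≼⇒⊏ (cons p) = there (≼⇒⊏ p)

≼-head : ∀ {n k s} → n ≤ k → n ∷ s ≼ k ∷ s
≼-head n≤k with m≤n⇒m<n∨m≡n n≤k
... | inj₁ n<k = bump n<k
... | inj₂ refl = same

++-≼ : ∀ t {u s} → u ≼ s → t ++ u ≼ s
++-≼ [] p = p
++-≼ (x ∷ t) p = cons (++-≼ t p)

≼-length : ∀ {u s} → u ≼ s → length s ≤ length u
≼-length same = ≤-refl
≼-length (bump _) = ≤-refl
≼-length (cons p) = m≤n⇒m≤1+n (≼-length p)

⊏-length : ∀ {m u s} → u ⊏[ m ] s → length s < length u
⊏-length (here _ p) = s≤s (≼-length p)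
⊏-length (there e) = m<n⇒m<1+n (⊏-length e)

≼-antisym : ∀ {u s} → u ≼ s → s ≼ u → u ≡ s
≼-antisym same _ = refl
≼-antisym (bump k<k′) same = ⊥-elim (<-irrefl refl k<k′)
≼-antisym (bump k<k′) (bump k′<k) = ⊥-elim (<-asym k<k′ k′<k)
≼-antisym (bump _) (cons q) = ⊥-elim (<-irrefl refl (≼-length q))
≼-antisym (cons p) q = ⊥-elim (<-irrefl refl (≤-trans (s≤s (≼-length p)) (≼-length q)))

⊑-refl : ∀ {x} → x ⊑ x
⊑-refl = along same

⊑-trans : ∀ {x y z} → x ⊑ y → y ⊑ z → x ⊑ z
⊑-trans (along p) (along q) = along (≼-trans p q)
⊑-trans (along p) (across e) = across (≼-⊏-trans p e)
⊑-trans (across e) (along q) = across (⊏-≼-trans e q)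
⊑-trans (across e) (across e′) = across (≼-⊏-trans (⊏⇒≼ e) e′)

⊑⇒≼ : ∀ {x y} → x ⊑ y → proj₂ x ≼ proj₂ y
⊑⇒≼ (along p) = p
⊑⇒≼ (across e) = ⊏⇒≼ e

⊑-len : ∀ {x y} → x ⊑ y → len y ≤ len x
⊑-len x⊑y = ≼-length (⊑⇒≼ x⊑y)

⊑-antisym : ∀ {x y} → x ⊑ y → y ⊑ x → x ≡ y
⊑-antisym (along p) (along q) = cong (_ ,_) (≼-antisym p q)
⊑-antisym (along p) (across e) = ⊥-elim (<⇒≱ (⊏-length e) (≼-length p))
⊑-antisym (across e) y⊑x = ⊥-elim (<⇒≱ (⊏-length e) (⊑-len y⊑x))

⊑-head : ∀ {m n k s} → n ≤ k → (m , n ∷ s) ⊑ (m , k ∷ s)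
⊑-head n≤k = along (≼-head n≤k)

⊑-tail : ∀ {m n s} → (m , n ∷ s) ⊑ (m , s)
⊑-tail = along (cons same)

pattern ≤H-refl = inj₂ refl
pattern step₁ p = inj₁ (inj₁ p)
pattern step₂ p = inj₁ (inj₂ (inj₁ p))
pattern step₃ p = inj₁ (inj₂ (inj₂ (inj₁ p)))
pattern step₂₁ p q = inj₁ (inj₂ (inj₂ (inj₂ (inj₁ (_ , p , q)))))
pattern step₃₁ p q = inj₁ (inj₂ (inj₂ (inj₂ (inj₂ (_ , p , q)))))

minL≤seed : ∀ x xs → minL x xs ≤ x
minL≤seed x [] = ≤-refl
minL≤seed x (y ∷ ys) = ≤-trans (m⊓n≤n y _) (minL≤seed x ys)

any⇒minL≤ : ∀ {m} x xs → Any (_≤ m) (x ∷ xs) → minL x xs ≤ m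
any⇒minL≤ x xs (Any.here x≤m) = ≤-trans (minL≤seed x xs) x≤m
any⇒minL≤ x (y ∷ ys) (Any.there (Any.here y≤m)) = ≤-trans (m⊓n≤m y _) y≤m
any⇒minL≤ x (y ∷ ys) (Any.there (Any.there a)) = ≤-trans (m⊓n≤n y _) (any⇒minL≤ x ys (Any.there a))

minL≤⇒any : ∀ {m} x xs → minL x xs ≤ m → Any (_≤ m) (x ∷ xs)
minL≤⇒any x [] x≤m = Any.here x≤m
minL≤⇒any {m} x (y ∷ ys) min≤m with ≤-total y (minL x ys)
... | inj₁ y≤ = Any.there (Any.here (subst (_≤ m) (m≤n⇒m⊓n≡m y≤) min≤m))
... | inj₂ ≤y with minL≤⇒any x ys (subst (_≤ m) (m≥n⇒m⊓n≡n ≤y) min≤m)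
...   | Any.here x≤m = Any.here x≤m
...   | Any.there a = Any.there (Any.there a)

any⇒⊏ : ∀ {m} t {v s} → Any (_≤ m) t → v ≼ s → t ++ v ⊏[ m ] s
any⇒⊏ (x ∷ t) (Any.here x≤m) p = here x≤m (++-≼ t p)
any⇒⊏ (x ∷ t) (Any.there a) p = there (any⇒⊏ t a p)

≤H⇒⊑ : ∀ {x y} → x ≤H y → x ⊑ y
≤H⇒⊑ ≤H-refl = ⊑-refl
≤H⇒⊑ (step₁ (lt1 k<k′)) = along (bump k<k′)
≤H⇒⊑ (step₂ (lt2 {x = x} {xs = xs})) = along (++-≼ (x ∷ xs) same)
≤H⇒⊑ (step₃ (lt3 {x = x} {xs = xs} min≤m)) = across (any⇒⊏ (x ∷ xs) (minL≤⇒any x xs min≤m) same)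
≤H⇒⊑ (step₂₁ (lt2 {x = x} {xs = xs}) (lt1 k<k′)) = along (++-≼ (x ∷ xs) (bump k<k′))
≤H⇒⊑ (step₃₁ (lt3 {x = x} {xs = xs} min≤m) (lt1 k<k′)) =
  across (any⇒⊏ (x ∷ xs) (minL≤⇒any x xs min≤m) (bump k<k′))

-- The converse is proved with an accumulated prefix t: each cons moves one entry of u into t.
≤H-move : ∀ {a z} t y u → (a , (t ++ [ y ]) ++ u) ≤H z → (a , t ++ y ∷ u) ≤H z
≤H-move {a} {z} t y u = subst (λ v → (a , v) ≤H z) (++-assoc t [ y ] u)

≼⇒≤H : ∀ {a u s} t → u ≼ s → (a , t ++ u) ≤H (a , s)
≼⇒≤H [] same = ≤H-refl
≼⇒≤H (x ∷ xs) same = step₂ lt2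
≼⇒≤H [] (bump k<k′) = step₁ (lt1 k<k′)
≼⇒≤H (x ∷ xs) (bump k<k′) = step₂₁ lt2 (lt1 k<k′)
≼⇒≤H t (cons {y} {u} p) = ≤H-move t y u (≼⇒≤H (t ++ [ y ]) p)

any-≼⇒≤H : ∀ {a m u s} t → Any (_≤ m) t → u ≼ s → (a , t ++ u) ≤H (m , s)
any-≼⇒≤H [] () _
any-≼⇒≤H (x ∷ xs) a same = step₃ (lt3 (any⇒minL≤ x xs a))
any-≼⇒≤H (x ∷ xs) a (bump k<k′) = step₃₁ (lt3 (any⇒minL≤ x xs a)) (lt1 k<k′)
any-≼⇒≤H t a (cons {y} {u} p) = ≤H-move t y u (any-≼⇒≤H (t ++ [ y ]) (++⁺ˡ a) p)

⊏⇒≤H : ∀ {a m u s} t → u ⊏[ m ] s → (a , t ++ u) ≤H (m , s)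
⊏⇒≤H t (here {x} {u} x≤m p) = ≤H-move t x u (any-≼⇒≤H (t ++ [ x ]) (++⁺ʳ t (Any.here x≤m)) p)
⊏⇒≤H t (there {x} {u} e) = ≤H-move t x u (⊏⇒≤H (t ++ [ x ]) e)

⊑⇒≤H : ∀ {x y} → x ⊑ y → x ≤H y
⊑⇒≤H (along p) = ≼⇒≤H [] p
⊑⇒≤H (across e) = ⊏⇒≤H [] e

≤H-isPartialOrder : IsPartialOrder _≡_ _≤H_
≤H-isPartialOrder = record
  { isPreorder = record
    { isEquivalence = isEquivalence
    ; reflexive     = λ { refl → ≤H-refl }
    ; trans         = λ x≤y y≤z → ⊑⇒≤H (⊑-trans (≤H⇒⊑ x≤y) (≤H⇒⊑ y≤z))
    }
  ; antisym = λ x≤y y≤x → ⊑-antisym (≤H⇒⊑ x≤y) (≤H⇒⊑ y≤x)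
  }

open IrreducibleCompletion (IsPartialOrder.isPreorder ≤H-isPartialOrder)

[]-⊑-maximal : ∀ {m z} → (m , []) ⊑ z → z ≡ (m , [])
[]-⊑-maximal (along same) = refl

∷-≼-cases : ∀ {n w s} → n ∷ w ≼ s → w ≼ s ⊎ ∃ λ n′ → n ≤ n′ × s ≡ n′ ∷ w
∷-≼-cases same = inj₂ (_ , ≤-refl , refl)
∷-≼-cases (bump n<n′) = inj₂ (_ , <⇒≤ n<n′ , refl)
∷-≼-cases (cons p) = inj₁ p

∷-⊑-cases : ∀ {c n w z} → (c , n ∷ w) ⊑ z →
  (c , w) ⊑ z ⊎ (∃ λ n′ → n ≤ n′ × z ≡ (c , n′ ∷ w)) ⊎ (n ≤ proj₁ z × w ≼ proj₂ z)
∷-⊑-cases (along same) = inj₂ (inj₁ (_ , ≤-refl , refl))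
∷-⊑-cases (along (bump n<n′)) = inj₂ (inj₁ (_ , <⇒≤ n<n′ , refl))
∷-⊑-cases (along (cons p)) = inj₁ (along p)
∷-⊑-cases (across (here n≤m p)) = inj₂ (inj₂ (n≤m , p))
∷-⊑-cases (across (there e)) = inj₁ (across e)

⊑-sameLength : ∀ {m k s z} → (m , k ∷ s) ⊑ z → len z ≡ suc (length s) →
  ∃ λ k′ → z ≡ (m , k′ ∷ s) × k ≤ k′
⊑-sameLength m⊑z eq with ∷-⊑-cases m⊑z
... | inj₁ s⊑z = ⊥-elim (<-irrefl eq (s≤s (⊑-len s⊑z)))
... | inj₂ (inj₁ (k′ , k≤k′ , z≡)) = k′ , z≡ , k≤k′
... | inj₂ (inj₂ (_ , p)) = ⊥-elim (<-irrefl eq (s≤s (≼-length p)))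

private
  hd : List ℕ → ℕ
  hd [] = 0
  hd (x ∷ _) = x

≼-limit : ∀ {w s} → (∀ n → n ∷ w ≼ s) → w ≼ s
≼-limit {s = s} f with ∷-≼-cases (f (suc (hd s)))
... | inj₁ w≼s = w≼s
... | inj₂ (n′ , le , refl) = ⊥-elim (<-irrefl refl le)

-- For n exceeding b and the head of u, where v = (b , u), only the first case of ∷-⊑-cases remains.
⊑-limit : ∀ {m s v} → (∀ n → (m , n ∷ s) ⊑ v) → (m , s) ⊑ v
⊑-limit {v = b , u} f with ∷-⊑-cases (f (suc (b + hd u)))
... | inj₁ s⊑v = s⊑v
... | inj₂ (inj₁ (n′ , le , refl)) = ⊥-elim (<-irrefl refl (≤-trans le (m≤n+m n′ b)))
... | inj₂ (inj₂ (le , _)) = ⊥-elim (<-irrefl refl (≤-trans le (m≤m+n b (hd u))))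

Cofinal : (ℕ → Set) → Set
Cofinal P = ∀ n → ∃ λ k → n ≤ k × P k

Bounded : (ℕ → Set) → Set
Bounded P = ∃ λ B → ∀ {k} → P k → k ≤ B

IsMaximalIn : Pred H 0ℓ → H → Set
IsMaximalIn X x = ∀ {z} → z ∈ X → x ⊑ z → z ≡ x

IsShortestAbove : Pred H 0ℓ → H → H → Set
IsShortestAbove X y e = e ∈ X × y ⊑ e × (∀ {z} → z ∈ X → y ⊑ z → len e ≤ len z)

shortest⇒stable : ∀ {X y e z} → IsShortestAbove X y e → z ∈ X → e ⊑ z → len z ≡ len e
shortest⇒stable (_ , y⊑e , shortest) z∈X e⊑z = ≤-antisym (⊑-len e⊑z) (shortest z∈X (⊑-trans y⊑e e⊑z))

-- Above a point e = (m , k ∷ s) of shortest string, X consists of points (m , k′ ∷ s) with k′ ≥ k: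
-- either these k′ are bounded and there is a top, or they are cofinal.
data Summit (X : Pred H 0ℓ) : H → Set where
  maximal : ∀ {e x} → x ∈ X → e ⊑ x → IsMaximalIn X x → Summit X e
  limit   : ∀ {m k s} → Cofinal (λ k′ → (m , k′ ∷ s) ∈ X) → Summit X (m , k ∷ s)

IsDownward : Pred H 0ℓ → Set
IsDownward C = ∀ {x y} → y ⊑ x → x ∈ C → y ∈ C

IsChainClosed : Pred H 0ℓ → Set
IsChainClosed C = ∀ {m s} → (∀ n → (m , n ∷ s) ∈ C) → (m , s) ∈ C

IsClosed : Pred H 0ℓ → Set
IsClosed C = IsDownward C × IsChainClosed C

cofinal⇒limit∈ : ∀ {X m s} → IsClosed X → Cofinal (λ k → (m , k ∷ s) ∈ X) → (m , s) ∈ X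
cofinal⇒limit∈ (down , chain) cofinal =
  chain λ n → let (k , n≤k , k∈X) = cofinal n in down (⊑-head n≤k) k∈X

data DirectedShape (D : Pred H 0ℓ) : Set where
  greatest : ∀ {e} → e ∈ D → (∀ {x} → x ∈ D → x ⊑ e) → DirectedShape D
  climbing : ∀ {m s} → (∀ {x} → x ∈ D → x ⊑ (m , s)) → Cofinal (λ k → (m , k ∷ s) ∈ D) →
             DirectedShape D

supPoint : ∀ {D} → DirectedShape D → H
supPoint (greatest {e} _ _) = e
supPoint (climbing {m} {s} _ _) = m , s

supPoint-isSup : ∀ {D} (shape : DirectedShape D) → OH.IsSup D (supPoint shape)
supPoint-isSup (greatest e∈D below) = (λ x∈D → ⊑⇒≤H (below x∈D)) , λ ub → ub e∈D
supPoint-isSup (climbing below cofinal) = (λ x∈D → ⊑⇒≤H (below x∈D)) , λ ub →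
  ⊑⇒≤H (⊑-limit λ n → let (k , n≤k , k∈D) = cofinal n in ⊑-trans (⊑-head n≤k) (≤H⇒⊑ (ub k∈D)))

supPoint∈ : ∀ {C D} (shape : DirectedShape D) → IsClosed C → D ⊆ C → supPoint shape ∈ C
supPoint∈ (greatest e∈D _) _ D⊆C = D⊆C e∈D
supPoint∈ (climbing _ cofinal) C-closed D⊆C =
  cofinal⇒limit∈ C-closed λ n → let (k , n≤k , k∈D) = cofinal n in k , n≤k , D⊆C k∈D

ω-chain : ℕ → List ℕ → Pred H 0ℓ
ω-chain m s x = ∃ λ n → x ≡ (m , n ∷ s)

ω-chain-isDirected : ∀ m s → OH.IsDirected (ω-chain m s)
ω-chain-isDirected m s = ((m , 0 ∷ s) , 0 , refl) , λ { (n₁ , refl) (n₂ , refl) →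
  (m , n₁ ⊔ n₂ ∷ s) , (_ , refl) , ⊑⇒≤H (⊑-head (m≤m⊔n n₁ n₂)) , ⊑⇒≤H (⊑-head (m≤n⊔m n₁ n₂)) }

ω-chain-isSup : ∀ m s → OH.IsSup (ω-chain m s) (m , s)
ω-chain-isSup m s =
  (λ { (_ , refl) → ⊑⇒≤H ⊑-tail }) , λ ub → ⊑⇒≤H (⊑-limit λ n → ≤H⇒⊑ (ub (n , refl)))

isScottClosed⇒isClosed : ∀ {C} → OH.IsScottClosed C → IsClosed C
isScottClosed⇒isClosed (lower , closed) =
  (λ y⊑x x∈C → lower (⊑⇒≤H y⊑x) x∈C) , λ {m} {s} chain∈C →
  closed (ω-chain m s) (ω-chain-isDirected m s) (λ { (n , refl) → chain∈C n }) (ω-chain-isSup m s)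

↓⊑-isClosed : ∀ x → IsClosed (_⊑ x)
↓⊑-isClosed x = (λ y⊑v v⊑x → ⊑-trans y⊑v v⊑x) , ⊑-limit

stringsBelow : List ℕ → Pred H 0ℓ
stringsBelow s x = proj₂ x ≼ s

stringsBelow-isClosed : ∀ s → IsClosed (stringsBelow s)
stringsBelow-isClosed s = (λ y⊑x x∈T → ≼-trans (⊑⇒≼ y⊑x) x∈T) , ≼-limit

cofinal⇒stringsBelow⊆ : ∀ {X s} → IsClosed X → Cofinal (λ k → (k , s) ∈ X) → stringsBelow s ⊆ X
cofinal⇒stringsBelow⊆ (down , chain) cofinal {c , w} w≼s =
  down (along w≼s) (chain λ n → let (k , n≤k , k∈X) = cofinal n in down (across (here n≤k same)) k∈X)

Full : Pred H 0ℓ → List ℕ → Set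
Full F w = ∀ c → (c , w) ∈ F

Full-≼ : ∀ {F w w′} → IsDownward F → w′ ≼ w → Full F w → Full F w′
Full-≼ down w′≼w full c = down (along w′≼w) (full c)

Full-limit : ∀ {F w} → IsChainClosed F → (∀ j → Full F (j ∷ w)) → Full F w
Full-limit chain full c = chain λ n → full n c

full-isClosed : ∀ {F} → IsClosed F → IsClosed (λ x → Full F (proj₂ x))
full-isClosed {F} (down , chain) =
  (λ y⊑x full → Full-≼ {F} down (⊑⇒≼ y⊑x) full) , λ {_} {s} → Full-limit {F} {s} chain

module _ (em₀ : ExcludedMiddle 0ℓ) where

  HasLeast : (ℕ → Set) → Set
  HasLeast P = ∃ λ k → P k × (∀ {j} → P j → k ≤ j)

  leastWitness : (P : ℕ → Set) → ∀ {n} → P n → HasLeast P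
  leastWitness P {n} = <-rec (λ n → P n → HasLeast P) step n
    where
    step : ∀ n → (∀ {j} → j < n → P j → HasLeast P) → P n → HasLeast P
    step n smaller pn with em₀ {∃ λ j → j < n × P j}
    ... | yes (j , j<n , pj) = smaller j<n pj
    ... | no ∄smaller = n , pn , λ {j} pj → ≮⇒≥ λ j<n → ∄smaller (j , j<n , pj)

  boundedMaximum : (P : ℕ → Set) → ∀ B → (∀ {k} → P k → k ≤ B) → ∀ {k} → P k →
    ∃ λ k* → P k* × k ≤ k* × (∀ {k′} → P k′ → k′ ≤ k*)
  boundedMaximum P B bound {k} pk with em₀ {P B}
  ... | yes pB = B , pB , bound pk , bound
  boundedMaximum P zero bound pk | no ¬pB = ⊥-elim (¬pB (subst P (n≤0⇒n≡0 (bound pk)) pk))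
  boundedMaximum P (suc B) bound pk | no ¬pB =
    boundedMaximum P B (λ pk′ → s≤s⁻¹ (≤∧≢⇒< (bound pk′) λ k′≡B → ¬pB (subst P k′≡B pk′))) pk

  bounded⊎cofinal : (P : ℕ → Set) → Bounded P ⊎ Cofinal P
  bounded⊎cofinal P with em₀ {Bounded P}
  ... | yes bounded = inj₁ bounded
  ... | no unbounded = inj₂ λ n → decidable-stable em₀ λ ∄above → unbounded
        (n , λ {k} pk → decidable-stable (k ≤? n) λ k≰n → ∄above (k , <⇒≤ (≰⇒> k≰n) , pk))

  shortestAbove : ∀ {X y} → y ∈ X → ∃ (IsShortestAbove X y)
  shortestAbove {X} {y} y∈X
    with leastWitness (λ ℓ → ∃ λ z → z ∈ X × y ⊑ z × len z ≡ ℓ) (y , y∈X , ⊑-refl , refl)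
  ... | _ , (e , e∈X , y⊑e , refl) , least =
    e , e∈X , y⊑e , λ z∈X y⊑z → least (_ , z∈X , y⊑z , refl)

  summit : ∀ {X y e} → IsShortestAbove X y e → Summit X e
  summit {e = m , []} (e∈X , _ , _) = maximal e∈X ⊑-refl λ _ → []-⊑-maximal
  summit {X} {e = m , k ∷ s} shortest@(e∈X , _ , _)
    with bounded⊎cofinal (λ k′ → (m , k′ ∷ s) ∈ X)
  ... | inj₂ cofinal = limit cofinal
  ... | inj₁ (B , bound) with boundedMaximum (λ k′ → (m , k′ ∷ s) ∈ X) B bound e∈X
  ...   | k* , k*∈X , k≤k* , k*-max = maximal k*∈X (⊑-head k≤k*) top
    where
    top : IsMaximalIn X (m , k* ∷ s)
    top z∈X k*⊑z
      with ⊑-sameLength k*⊑z (shortest⇒stable shortest z∈X (⊑-trans (⊑-head k≤k*) k*⊑z))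
    ... | k′ , refl , k*≤k′ = cong (λ k → m , k ∷ s) (≤-antisym (k*-max z∈X) k*≤k′)

  maximalAbove : ∀ {X y} → IsClosed X → y ∈ X → ∃ λ x → x ∈ X × y ⊑ x × IsMaximalIn X x
  maximalAbove X-closed y∈X with shortestAbove y∈X
  ... | e , shortest@(_ , y⊑e , least) with summit shortest
  ...   | maximal x∈X e⊑x x-max = _ , x∈X , ⊑-trans y⊑e e⊑x , x-max
  ...   | limit cofinal =
    ⊥-elim (1+n≰n (least (cofinal⇒limit∈ X-closed cofinal) (⊑-trans y⊑e ⊑-tail)))

  directedShape : ∀ {D} → OH.IsDirected D → DirectedShape D
  directedShape {D} ((d , d∈D) , directed) with shortestAbove {D} d∈D
  ... | e , shortest@(e∈D , _ , _) with summit shortest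
  ...   | maximal x∈D _ x-max = greatest x∈D below
    where
    below : ∀ {w} → w ∈ D → w ⊑ _
    below w∈D with directed w∈D x∈D
    ... | z , z∈D , w≤z , x≤z = subst (_ ⊑_) (x-max z∈D (≤H⇒⊑ x≤z)) (≤H⇒⊑ w≤z)
  ...   | limit cofinal = climbing below cofinal
    where
    below : ∀ {w} → w ∈ D → w ⊑ _
    below w∈D with directed w∈D e∈D
    ... | z , z∈D , w≤z , e≤z
        with ⊑-sameLength (≤H⇒⊑ e≤z) (shortest⇒stable shortest z∈D (≤H⇒⊑ e≤z))
    ...   | _ , refl , _ = ⊑-trans (≤H⇒⊑ w≤z) ⊑-tail

  ≤H-isDirectedComplete : OH.IsDirectedComplete 0ℓ
  ≤H-isDirectedComplete D D-directed =
    let shape = directedShape D-directed in supPoint shape , supPoint-isSup shape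

  isClosed⇒isScottClosed : ∀ {C} → IsClosed C → OH.IsScottClosed C
  isClosed⇒isScottClosed C-closed@(down , _) =
    (λ y≤x x∈C → down (≤H⇒⊑ y≤x) x∈C) , λ D D-directed D⊆C (_ , u-least) →
    let shape = directedShape D-directed
    in down (≤H⇒⊑ (u-least (proj₁ (supPoint-isSup shape)))) (supPoint∈ shape C-closed D⊆C)

  splitIrreducible : ∀ {F P Q} → OH.IsIrreducible F → IsClosed P → IsClosed Q →
    F ⊆ P ∪ Q → F ⊆ P ⊎ F ⊆ Q
  splitIrreducible (_ , split) P-closed Q-closed =
    split _ _ (isClosed⇒isScottClosed P-closed) (isClosed⇒isScottClosed Q-closed)

  stringsBelow-isIrreducible : ∀ s → OH.IsIrreducible (stringsBelow s)
  stringsBelow-isIrreducible s = ((0 , s) , same) , split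
    where
    split : ∀ P Q → OH.IsScottClosed P → OH.IsScottClosed Q →
      stringsBelow s ⊆ P ∪ Q → stringsBelow s ⊆ P ⊎ stringsBelow s ⊆ Q
    split P Q P-closed Q-closed T⊆P∪Q with bounded⊎cofinal (λ k → (k , s) ∈ P)
    ... | inj₂ cofinal = inj₁ (cofinal⇒stringsBelow⊆ (isScottClosed⇒isClosed P-closed) cofinal)
    ... | inj₁ (B , bound) = inj₂ (cofinal⇒stringsBelow⊆ (isScottClosed⇒isClosed Q-closed)
                                     λ n → suc (n + B) , m≤n⇒m≤1+n (m≤m+n n B) , beyondP n)
      where
      beyondP : ∀ n → (suc (n + B) , s) ∈ Q
      beyondP n with T⊆P∪Q {suc (n + B) , s} same
      ... | inj₁ ∈P = ⊥-elim (1+n≰n (≤-trans (s≤s (m≤n+m B n)) (bound ∈P)))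
      ... | inj₂ ∈Q = ∈Q

  module _ {F : Pred H 0ℓ} (F-closed : IsClosed F) (F-irreducible : OH.IsIrreducible F) where
    private
      down : IsDownward F
      down = proj₁ F-closed
      chain-closed : IsChainClosed F
      chain-closed = proj₂ F-closed

    IsPrincipal : Set
    IsPrincipal = ∃ λ x → x ∈ F × F ⊆ (_⊑ x)

    -- For x maximal in F, the closed sets ↓x and EscapingOrFull x cover F; irreducibility and
    -- non-principality put x, hence every point of F, in the full part.
    Escaping : H → Pred H 0ℓ
    Escaping x v = ∃ λ z → z ∈ F × ¬ z ⊑ x × v ⊑ z

    FullStrings : Pred H 0ℓ
    FullStrings x = Full F (proj₂ x)

    EscapingOrFull : H → Pred H 0ℓ
    EscapingOrFull x = Escaping x ∪ FullStrings

    escapingOrFull-isClosed : ∀ x → IsClosed (EscapingOrFull x)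
    escapingOrFull-isClosed x = lower , chain
      where
      ⊆F : EscapingOrFull x ⊆ F
      ⊆F (inj₁ (z , z∈F , _ , v⊑z)) = down v⊑z z∈F
      ⊆F {v} (inj₂ full) = full (proj₁ v)
      lower : IsDownward (EscapingOrFull x)
      lower y⊑v (inj₁ (z , z∈F , z⋢x , v⊑z)) = inj₁ (z , z∈F , z⋢x , ⊑-trans y⊑v v⊑z)
      lower y⊑v (inj₂ full) = inj₂ (Full-≼ {F} down (⊑⇒≼ y⊑v) full)
      someNotFull : ∀ {w} → ¬ Full F w → ∃ λ j → ¬ Full F (j ∷ w)
      someNotFull ¬full = decidable-stable em₀ λ ∄j → ¬full (Full-limit {F} chain-closed λ j →
        decidable-stable em₀ λ ¬fullj → ∄j (j , ¬fullj))
      chain : IsChainClosed (EscapingOrFull x)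
      chain {c} {w} f with em₀ {(c , w) ⊑ x} | em₀ {Full F w}
      ... | no cw⋢x | _ = inj₁ ((c , w) , chain-closed (λ n → ⊆F (f n)) , cw⋢x , ⊑-refl)
      ... | yes _ | yes full = inj₂ full
      ... | yes cw⊑x | no ¬full with someNotFull ¬full
      ...   | j , ¬fullj with f j
      ...     | inj₂ fullj = ⊥-elim (¬fullj fullj)
      ...     | inj₁ (z , z∈F , z⋢x , cjw⊑z) with ∷-⊑-cases cjw⊑z
      ...       | inj₁ cw⊑z = inj₁ (z , z∈F , z⋢x , cw⊑z)
      ...       | inj₂ (inj₁ (_ , _ , refl)) = ⊥-elim (z⋢x (⊑-trans ⊑-tail cw⊑x))
      ...       | inj₂ (inj₂ (j≤ , w≼)) = ⊥-elim (¬fullj λ d → down (across (here j≤ w≼)) z∈F)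

    belowOrEscaping : ∀ x → F ⊆ (_⊑ x) ∪ EscapingOrFull x
    belowOrEscaping x {v} v∈F with em₀ {v ⊑ x}
    ... | yes v⊑x = inj₁ v⊑x
    ... | no v⋢x = inj₂ (inj₁ (v , v∈F , v⋢x , ⊑-refl))

    nonPrincipal⇒full : ¬ IsPrincipal → F ⊆ FullStrings
    nonPrincipal⇒full ¬principal y∈F with maximalAbove F-closed y∈F
    ... | x , x∈F , y⊑x , x-max
        with splitIrreducible F-irreducible
               (↓⊑-isClosed x) (escapingOrFull-isClosed x) (belowOrEscaping x)
    ...   | inj₁ F⊆↓x = ⊥-elim (¬principal (x , x∈F , F⊆↓x))
    ...   | inj₂ F⊆Q with F⊆Q x∈F
    ...     | inj₂ full = Full-≼ {F} down (⊑⇒≼ y⊑x) full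
    ...     | inj₁ (z , z∈F , z⋢x , x⊑z) with x-max z∈F x⊑z
    ...       | refl = ⊥-elim (z⋢x ⊑-refl)

    -- For (c , s) maximal among the full strings, F ⊆ stringsBelow s ∪ Beyond s, and (c , s) ∉ Beyond s.
    Beyond : List ℕ → Pred H 0ℓ
    Beyond s v = ∃ λ s′ → Full F s′ × proj₂ v ≼ s′ × ¬ s′ ≼ s

    beyond-isClosed : ∀ s → IsClosed (Beyond s)
    beyond-isClosed s = lower , λ {m} → chain {m}
      where
      lower : IsDownward (Beyond s)
      lower y⊑v (s′ , full , v≼s′ , s′⋠s) = s′ , full , ≼-trans (⊑⇒≼ y⊑v) v≼s′ , s′⋠s
      chain : IsChainClosed (Beyond s)
      chain {c} {w} f with em₀ {Beyond s (c , w)}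
      ... | yes beyond = beyond
      ... | no ¬beyond = w , Full-limit {F} chain-closed (λ j → proj₁ (step j)) , same , proj₂ (step 0)
        where
        step : ∀ j → Full F (j ∷ w) × ¬ w ≼ s
        step j with f j
        ... | s′ , full , jw≼s′ , s′⋠s with ∷-≼-cases jw≼s′
        ...   | inj₁ w≼s′ = ⊥-elim (¬beyond (s′ , full , w≼s′ , s′⋠s))
        ...   | inj₂ (_ , j≤n′ , refl) = Full-≼ {F} down (≼-head j≤n′) full , λ w≼s → s′⋠s (cons w≼s)

    belowOrBeyond : F ⊆ FullStrings → ∀ s → F ⊆ stringsBelow s ∪ Beyond s
    belowOrBeyond allFull s {v} v∈F with em₀ {proj₂ v ≼ s}
    ... | yes v≼s = inj₁ v≼s
    ... | no v⋠s = inj₂ (proj₂ v , allFull v∈F , same , v⋠s)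

    allFull⇒stringsBelow : F ⊆ FullStrings → ∃ λ s → F ⊆ stringsBelow s × Full F s
    allFull⇒stringsBelow allFull with proj₁ F-irreducible
    ... | y₀ , y₀∈F with maximalAbove {FullStrings} {y₀} (full-isClosed F-closed) (allFull y₀∈F)
    ...   | (c , s) , s-full , _ , s-max
          with splitIrreducible F-irreducible
                 (stringsBelow-isClosed s) (beyond-isClosed s) (belowOrBeyond allFull s)
    ...     | inj₁ F⊆T = s , F⊆T , s-full
    ...     | inj₂ F⊆R with F⊆R (s-full c)
    ...       | s′ , s′-full , s≼s′ , s′⋠s with s-max {c , s′} s′-full (along s≼s′)
    ...         | refl = ⊥-elim (s′⋠s same)

    irreducibleShape : IsPrincipal ⊎ ∃ λ s → F ⊆ stringsBelow s × Full F s
    irreducibleShape with em₀ {IsPrincipal}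
    ... | yes principal = inj₁ principal
    ... | no ¬principal = inj₂ (allFull⇒stringsBelow (nonPrincipal⇒full ¬principal))

  stringsIrr : List ℕ → Irr
  stringsIrr s =
    stringsBelow s , isClosed⇒isScottClosed (stringsBelow-isClosed s) , stringsBelow-isIrreducible s

  stringsBelow-isApproximable : ∀ F s → proj₁ F ⊆ stringsBelow s → Full (proj₁ F) s → IsApproximable F
  stringsBelow-isApproximable F@(C , C-scottClosed , _) s C⊆T s-full =
    𝒟 , directed , ((λ {G} → ub {G}) , (λ {V} → least {V})) , λ {G} → below-points {G}
    where
    C-down : IsDownward C
    C-down = proj₁ (isScottClosed⇒isClosed C-scottClosed)
    𝒟 : Pred Irr 0ℓ
    𝒟 G = ∃ λ n → G ⊆ᴵ stringsIrr (n ∷ s)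
    directed : I.IsDirected 𝒟
    directed = (stringsIrr (0 ∷ s) , 0 , (λ y∈ → y∈)) , λ (n₁ , G₁⊆) (n₂ , G₂⊆) →
      stringsIrr (n₁ ⊔ n₂ ∷ s) , (n₁ ⊔ n₂ , (λ y∈ → y∈))
      , (λ y∈G₁ → ≼-trans (G₁⊆ y∈G₁) (≼-head (m≤m⊔n n₁ n₂)))
      , (λ y∈G₂ → ≼-trans (G₂⊆ y∈G₂) (≼-head (m≤n⊔m n₁ n₂)))
    ub : I.IsUpperBound 𝒟 F
    ub (_ , G⊆) y∈G = C-down (along (≼-trans (G⊆ y∈G) (cons same))) (s-full _)
    least : ∀ {V} → I.IsUpperBound 𝒟 V → F ⊆ᴵ V
    least {V , V-scottClosed , _} ubV {c , w} y∈C = V-down (along (C⊆T y∈C))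
      (V-chain λ n → ubV {stringsIrr (n ∷ s)} (n , (λ y∈ → y∈)) {c , n ∷ s} same)
      where
      open Σ (isScottClosed⇒isClosed V-scottClosed) renaming (proj₁ to V-down; proj₂ to V-chain)
    below-points : ∀ {G} → G ∈ 𝒟 → ∃ λ x → x ∈ C × G ⊆ᴵ principal x
    below-points (n , G⊆) = (n , s) , s-full n , λ y∈G → ⊑⇒≤H (across (≼⇒⊏ (G⊆ y∈G)))

  isApproximable : ∀ F → IsApproximable F
  isApproximable F@(C , C-scottClosed , C-irreducible)
    with irreducibleShape (isScottClosed⇒isClosed C-scottClosed) C-irreducible
  ... | inj₁ (x , x∈C , C⊆↓x) = principal-isApproximable F x∈C λ y∈C → ⊑⇒≤H (C⊆↓x y∈C)
  ... | inj₂ (s , C⊆T , s-full) = stringsBelow-isApproximable F s C⊆T s-full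

theorem4p1 : ExcludedMiddle 0ℓ → ExcludedMiddle (lsuc 0ℓ) →
    IsPartialOrder _≡_ _≤H_
    × OH.IsDirectedComplete 0ℓ
    × OrderIso ΓH OH._⊆Γ_ ΓIrrH OIrr._⊆Γ_
theorem4p1 em₀ em₁ = ≤H-isPartialOrder , ≤H-isDirectedComplete em₀ , Γ≅ΓIrr em₀ em₁ (isApproximable em₀)
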